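{- (Permutations.) In $LG^\omega$, let $\Pi$ be a proof of $\Sigma;B_1,\dots,B_n\vdash B_0$ and let $\pi_0,\dots,\pi_n$ be permutations. Then there exists a proof $\Pi'$ of $\Sigma;\pi_1.B_1,\dots,\pi_n.B_n\vdash\pi_0.B_0$ such that $ht(\Pi')\le ht(\Pi)$.
   Context: Logic $LG^\omega$. Terms: Church's simply typed $\lambda$-calculus; formulas have type $o$; quantifier types do not contain $o$. There are distinguished nominal types, each with infinitely many nominal constants, plus a set $\mathcal K$ of other constants. A permutation $\pi$ is a finite type-preserving bijection on nominal constants, acting on terms by $\pi.t$ (renaming nominal constants only; variables and other constants fixed). $supp(t)$ = set of nominal constants in $t$. $\Sigma$-substitutions map variables to terms with no nominal constants. Sequents: $\Sigma;\Gamma\vdash C$, $\Gamma$ a multiset, free variables among $\Sigma$. Rules: $id_\pi$ ($\Sigma;\Gamma,B\vdash B'$ if $\pi.B=\pi'.B'$ for some permutations); multicut $mc$ (from $\Sigma;\Delta_i\vdash B_i$, $i=1..n$, and $\Sigma;B_1..B_n,\Gamma\vdash C$ infer $\Sigma;\Delta_1..\Delta_n,\Gamma\vdash C$); contraction; $\bot L$, $\top R$; usual $\land,\lor,\supset$ rules; $\forall L$, $\exists R$ instantiate with any well-typed term over $\Sigma$, $\mathcal K$ and nominal constants; $\forall R$ (resp. $\exists L$): from $\Sigma,h;\Gamma\vdash B[h\,\vec c/x]$ infer $\Sigma;\Gamma\vdash\forall x.B$ (dually on the left for $\exists$), $h\notin\Sigma$, $\vec c$ listing $supp(B)$, $h$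 of type raised over the types of $\vec c$; $\nabla L,\nabla R$: replace the $\nabla$-bound variable (of nominal type) by a nominal constant $a\notin supp(B)$; $eqR$: $\Sigma;\Gamma\vdash t=t$; $eqL$: from premises $\Sigma\theta;\Gamma\theta\vdash C\theta$ for every $\Sigma$-substitution $\theta$ with $(\lambda\vec c.s)\theta=_{\beta\eta}(\lambda\vec c.t)\theta$, $\vec c$ listing $supp(s=t)$, infer $\Sigma;\Gamma,s=t\vdash C$; $defL/defR$: unfold an atom $p\,\vec t$ to $B[\vec t/\vec x]$ for a stratified definition clause $\forall\vec x.p\,\vec x\stackrel{\triangle}{=}B$ (body level $\le$ level of $p$, where implication raises the level of its antecedent by one, and body free of nominal constants); $natR$: $\vdash nat\,z$, and from $\Gamma\vdash nat\,I$ infer $\Gamma\vdash nat\,(s\,I)$ ($z:nt$, $s:nt\to nt$); $natL$: from $\vdash D\,z$, $j;D\,j\vdash D\,(s\,j)$ and $\Sigma;\Gamma,D\,I\vdash C$ infer $\Sigma;\Gamma,nat\,I\vdash C$. Height $ht(\Pi)$ is the least upper bound of $ht(\Pi_i)+1$ over premise derivations $\Pi_i$. -}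

module Defs where

open import Data.Nat using (ℕ; zero; suc; _≤_; _⊔_; _≟_)
open import Data.Bool using (Bool; true; false; T)
open import Data.Unit using (⊤; tt)
open import Data.Empty using (⊥)
open import Data.Product using (Σ; _×_; _,_; proj₁; proj₂)
open import Data.Sum using (_⊎_; inj₁; inj₂)
open import Data.List using (List; []; _∷_; map; _++_; concat; foldr)
open import Data.List.Relation.Unary.All using (All)
open import Data.List.Membership.Propositional using (_∈_)
open import Data.List.Relation.Unary.Unique.Propositional using (Unique)
open import Data.List.Relation.Binary.Permutation.Propositional using (_↭_)
open import Data.Fin using (Fin)
import Data.Fin as Fin
import Data.Vec.Functional as VF
open import Relation.Nullary using (¬_; yes; no)
open import Relation.Binary.PropositionalEquality using (_≡_; refl)

-- Simple types.  o = formulas; nomT k = the k-th nominal type;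
-- base k = other base types; nt = the type of natural numbers.

data Ty : Set where
  o     : Ty
  nomT  : ℕ → Ty
  base  : ℕ → Ty
  nt    : Ty
  _⇒_   : Ty → Ty → Ty

infixr 7 _⇒_

noO : Ty → Bool
noO o        = false
noO (nomT _) = true
noO (base _) = true
noO nt       = true
noO (σ ⇒ τ) with noO σ
... | false = false
... | true  = noO τ

data IsBase : Ty → Set where
  bo    : IsBase o
  bnom  : ∀ k → IsBase (nomT k)
  bbase : ∀ k → IsBase (base k)
  bnt   : IsBase nt

Ctx : Set
Ctx = List Ty

data _∋_ : Ctx → Ty → Set where
  here  : ∀ {Γ τ} → (τ ∷ Γ) ∋ τ
  there : ∀ {Γ σ τ} → Γ ∋ τ → (σ ∷ Γ) ∋ τ

data LogCon : Ty → Set where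
  top bot     : LogCon o
  and or imp  : LogCon (o ⇒ o ⇒ o)
  all ex      : (τ : Ty) → T (noO τ) → LogCon ((τ ⇒ o) ⇒ o)
  nab         : (k : ℕ) → LogCon ((nomT k ⇒ o) ⇒ o)
  eq          : (τ : Ty) → T (noO τ) → LogCon (τ ⇒ τ ⇒ o)
  natc        : LogCon (nt ⇒ o)
  zc          : LogCon nt
  sc          : LogCon (nt ⇒ nt)

-- Signature: the set K of other constants (Con), among which the
-- defined predicate constants (Pred), with their types.
record Sig : Set₁ where
  field
    Con        : Set
    conTy      : Con → Ty
    Pred       : Set
    predArgs   : Pred → List Ty
    predArgsOK : ∀ p → All (λ τ → T (noO τ)) (predArgs p)

  predTy : Pred → Ty
  predTy p = foldr _⇒_ o (predArgs p)

-- Ordinals (Brouwer trees).  node I f denotes  lub_i (f i + 1).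
data Ord : Set₁ where
  node : (I : Set) → (I → Ord) → Ord

_≤o_ : Ord → Ord → Set
_<o_ : Ord → Ord → Set
node I f ≤o b = (i : I) → f i <o b
a <o node J g = Σ J (λ j → a ≤o g j)

-- Terms of the simply typed λ-calculus, kept in β-normal η-long form
-- (so βη-convertibility is syntactic equality).

module Terms (S : Sig) where
  open Sig S

  data Head (Γ : Ctx) : Ty → Set where
    var : ∀ {τ} → Γ ∋ τ → Head Γ τ
    nm  : (k i : ℕ) → Head Γ (nomT k)
    con : (c : Con) → Head Γ (conTy c)
    pc  : (p : Pred) → Head Γ (predTy p)
    lc  : ∀ {τ} → LogCon τ → Head Γ τ

  data Nf (Γ : Ctx) : Ty → Set
  data Sp (Γ : Ctx) (σ : Ty) : Ty → Set
  data Ne (Γ : Ctx) (τ : Ty) : Set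

  data Nf Γ where
    lam : ∀ {σ τ} → Nf (σ ∷ Γ) τ → Nf Γ (σ ⇒ τ)
    ne  : ∀ {τ} → IsBase τ → Ne Γ τ → Nf Γ τ

  data Sp Γ σ where
    ε   : Sp Γ σ σ
    _▹_ : ∀ {α β} → Sp Γ σ (α ⇒ β) → Nf Γ α → Sp Γ σ β

  data Ne Γ τ where
    _∙_ : ∀ {σ} → Head Γ σ → Sp Γ σ τ → Ne Γ τ

  infixl 5 _▹_

  Fm : Ctx → Set
  Fm Γ = Nf Γ o

  Ren : Ctx → Ctx → Set
  Ren Γ Δ = ∀ {τ} → Γ ∋ τ → Δ ∋ τ

  extR : ∀ {Γ Δ σ} → Ren Γ Δ → Ren (σ ∷ Γ) (σ ∷ Δ)
  extR ρ here      = here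
  extR ρ (there x) = there (ρ x)

  renH : ∀ {Γ Δ τ} → Ren Γ Δ → Head Γ τ → Head Δ τ
  renH ρ (var x)  = var (ρ x)
  renH ρ (nm k i) = nm k i
  renH ρ (con c)  = con c
  renH ρ (pc p)   = pc p
  renH ρ (lc l)   = lc l

  renNf : ∀ {Γ Δ τ} → Ren Γ Δ → Nf Γ τ → Nf Δ τ
  renSp : ∀ {Γ Δ σ τ} → Ren Γ Δ → Sp Γ σ τ → Sp Δ σ τ
  renNe : ∀ {Γ Δ τ} → Ren Γ Δ → Ne Γ τ → Ne Δ τ
  renNf ρ (lam t)  = lam (renNf (extR ρ) t)
  renNf ρ (ne b n) = ne b (renNe ρ n)
  renSp ρ ε        = ε
  renSp ρ (s ▹ u)  = renSp ρ s ▹ renNf ρ u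
  renNe ρ (h ∙ s)  = renH ρ h ∙ renSp ρ s

  -- normalisation by evaluation (gives hereditary substitution)
  Sem : Ctx → Ty → Set
  Sem Γ o        = Ne Γ o
  Sem Γ (nomT k) = Ne Γ (nomT k)
  Sem Γ (base k) = Ne Γ (base k)
  Sem Γ nt       = Ne Γ nt
  Sem Γ (σ ⇒ τ)  = ∀ {Δ} → Ren Γ Δ → Sem Δ σ → Sem Δ τ

  renSem : ∀ {Γ Δ} τ → Ren Γ Δ → Sem Γ τ → Sem Δ τ
  renSem o        ρ n = renNe ρ n
  renSem (nomT k) ρ n = renNe ρ n
  renSem (base k) ρ n = renNe ρ n
  renSem nt       ρ n = renNe ρ n
  renSem (σ ⇒ τ)  ρ f = λ ρ' s → f (λ x → ρ' (ρ x)) s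

  reflect : ∀ {Γ} τ → Ne Γ τ → Sem Γ τ
  reify   : ∀ {Γ} τ → Sem Γ τ → Nf Γ τ
  reflect o        n = n
  reflect (nomT k) n = n
  reflect (base k) n = n
  reflect nt       n = n
  reflect (σ ⇒ τ) (h ∙ s) = λ ρ v → reflect τ (renH ρ h ∙ (renSp ρ s ▹ reify σ v))
  reify o        n = ne bo n
  reify (nomT k) n = ne (bnom k) n
  reify (base k) n = ne (bbase k) n
  reify nt       n = ne bnt n
  reify (σ ⇒ τ)  f = lam (reify τ (f there (reflect σ (var here ∙ ε))))

  Env : Ctx → Ctx → Set
  Env Γ Δ = ∀ {τ} → Γ ∋ τ → Sem Δ τ

  extE : ∀ {Γ Δ σ} → Env Γ Δ → Sem Δ σ → Env (σ ∷ Γ) Δ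
  extE η v here      = v
  extE η v (there x) = η x

  idEnv : ∀ {Γ} → Env Γ Γ
  idEnv {τ = τ} x = reflect τ (var x ∙ ε)

  evalH  : ∀ {Γ Δ τ} → Head Γ τ → Env Γ Δ → Sem Δ τ
  evalH (var x)          η = η x
  evalH (nm k i)         η = reflect (nomT k) (nm k i ∙ ε)
  evalH (con c)          η = reflect (conTy c) (con c ∙ ε)
  evalH (pc p)           η = reflect (predTy p) (pc p ∙ ε)
  evalH (lc {τ} l)       η = reflect τ (lc l ∙ ε)

  eval   : ∀ {Γ Δ τ} → Nf Γ τ → Env Γ Δ → Sem Δ τ
  evalSp : ∀ {Γ Δ σ τ} → Sp Γ σ τ → Sem Δ σ → Env Γ Δ → Sem Δ τ
  eval (lam {σ} t) η = λ ρ v → eval t (extE (λ {τ} x → renSem τ ρ (η x)) v)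
  eval (ne b (h ∙ s)) η = evalSp s (evalH h η) η
  evalSp ε v η = v
  evalSp (s ▹ u) v η = evalSp s v η (λ x → x) (eval u η)

  Subst : Ctx → Ctx → Set
  Subst Γ Δ = ∀ {τ} → Γ ∋ τ → Nf Δ τ

  sub : ∀ {Γ Δ τ} → Nf Γ τ → Subst Γ Δ → Nf Δ τ
  sub {τ = τ} t θ = reify τ (eval t (λ x → eval (θ x) idEnv))

  napp : ∀ {Γ σ τ} → Nf Γ (σ ⇒ τ) → Nf Γ σ → Nf Γ τ
  napp {τ = τ} t u = reify τ (eval t idEnv (λ x → x) (eval u idEnv))

  appSp : ∀ {Γ σ τ} → Nf Γ σ → Sp Γ σ τ → Nf Γ τ
  appSp {τ = τ} t s = reify τ (evalSp s (eval t idEnv) idEnv)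

  wk : ∀ {Γ σ τ} → Nf Γ τ → Nf (σ ∷ Γ) τ
  wk = renNf there

  wk0 : ∀ {Γ τ} → Nf [] τ → Nf Γ τ
  wk0 = renNf (λ ())

  NomC : Set
  NomC = ℕ × ℕ         -- (k , i) : the i-th nominal constant of type nomT k

  occH  : ∀ {Γ τ} → NomC → Head Γ τ → Set
  occH c (nm k i) = c ≡ (k , i)
  occH c _        = ⊥

  occNf : ∀ {Γ τ} → NomC → Nf Γ τ → Set
  occSp : ∀ {Γ σ τ} → NomC → Sp Γ σ τ → Set
  occNf c (lam t)        = occNf c t
  occNf c (ne b (h ∙ s)) = occH c h ⊎ occSp c s
  occSp c ε              = ⊥
  occSp c (s ▹ u)        = occSp c s ⊎ occNf c u

  _∈supp_ : ∀ {Γ τ} → NomC → Nf Γ τ → Set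
  c ∈supp t = occNf c t

  Lists : ∀ {Γ τ} → List NomC → Nf Γ τ → Set
  Lists cs t = Unique cs × (∀ c → (c ∈ cs → c ∈supp t) × (c ∈supp t → c ∈ cs))

  NoNom : ∀ {Γ τ} → Nf Γ τ → Set
  NoNom t = ∀ c → ¬ (c ∈supp t)

  record Perm : Set where
    field
      fun   : ℕ → ℕ → ℕ
      inv   : ℕ → ℕ → ℕ
      fi    : ∀ k i → fun k (inv k i) ≡ i
      if    : ∀ k i → inv k (fun k i) ≡ i
      bound : ℕ
      fin   : ∀ k i → (bound ≤ k ⊎ bound ≤ i) → fun k i ≡ i

  permH : ∀ {Γ τ} → Perm → Head Γ τ → Head Γ τ
  permH π (nm k i) = nm k (Perm.fun π k i)
  permH π h        = h

  permNf : ∀ {Γ τ} → Perm → Nf Γ τ → Nf Γ τ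
  permSp : ∀ {Γ σ τ} → Perm → Sp Γ σ τ → Sp Γ σ τ
  permNf π (lam t)        = lam (permNf π t)
  permNf π (ne b (h ∙ s)) = ne b (permH π h ∙ permSp π s)
  permSp π ε              = ε
  permSp π (s ▹ u)        = permSp π s ▹ permNf π u

  _·_ : ∀ {Γ τ} → Perm → Nf Γ τ → Nf Γ τ
  π · t = permNf π t

  infixr 9 _·_

  raise : List NomC → Ty → Ty
  raise []             τ = τ
  raise ((k , _) ∷ cs) τ = nomT k ⇒ raise cs τ

  bindH : ∀ {Γ τ} (c : NomC) → Head Γ τ → Head (nomT (proj₁ c) ∷ Γ) τ
  bindH (k' , i') (nm k i) with k ≟ k' | i ≟ i'
  ... | yes refl | yes refl = var here
  ... | _        | _        = nm k i
  bindH c (var x) = var (there x)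
  bindH c (con d) = con d
  bindH c (pc p)  = pc p
  bindH c (lc l)  = lc l

  bindNf : ∀ {Γ τ} (c : NomC) → Nf Γ τ → Nf (nomT (proj₁ c) ∷ Γ) τ
  bindSp : ∀ {Γ σ τ} (c : NomC) → Sp Γ σ τ → Sp (nomT (proj₁ c) ∷ Γ) σ τ
  bindNf c (lam t)        = lam (renNf swap (bindNf c t))
    where
    swap : ∀ {a b Γ} → Ren (a ∷ b ∷ Γ) (b ∷ a ∷ Γ)
    swap here              = there here
    swap (there here)      = here
    swap (there (there x)) = there (there x)
  bindNf c (ne b (h ∙ s)) = ne b (bindH c h ∙ bindSp c s)
  bindSp c ε              = ε
  bindSp c (s ▹ u)        = bindSp c s ▹ bindNf c u

  abs : ∀ {Γ τ} (cs : List NomC) → Nf Γ τ → Nf Γ (raise cs τ)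
  abs []       t = t
  abs (c ∷ cs) t = lam (abs cs (bindNf c t))

  nmNf : ∀ {Γ} (c : NomC) → Nf Γ (nomT (proj₁ c))
  nmNf (k , i) = ne (bnom k) (nm k i ∙ ε)

  spineNm : ∀ {Γ σ τ} (cs : List NomC) → Sp Γ σ (raise cs τ) → Sp Γ σ τ
  spineNm []       s = s
  spineNm (c ∷ cs) s = spineNm cs (s ▹ nmNf c)

  hApp : ∀ {Γ} τ (cs : List NomC) → Nf (raise cs τ ∷ Γ) τ
  hApp τ cs = reify τ (reflect τ (var here ∙ spineNm cs ε))

  NoNomSub : ∀ {Γ Δ} → Subst Γ Δ → Set
  NoNomSub {Γ} θ = ∀ {τ} (x : Γ ∋ τ) → NoNom (θ x)

  ⊤F ⊥F : ∀ {Γ} → Fm Γ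
  ⊤F = ne bo (lc top ∙ ε)
  ⊥F = ne bo (lc bot ∙ ε)

  _∧F_ _∨F_ _⊃F_ : ∀ {Γ} → Fm Γ → Fm Γ → Fm Γ
  B ∧F C = ne bo (lc and ∙ (ε ▹ B ▹ C))
  B ∨F C = ne bo (lc or  ∙ (ε ▹ B ▹ C))
  B ⊃F C = ne bo (lc imp ∙ (ε ▹ B ▹ C))

  ∀F ∃F : ∀ {Γ} (τ : Ty) → T (noO τ) → Nf Γ (τ ⇒ o) → Fm Γ
  ∀F τ p B = ne bo (lc (all τ p) ∙ (ε ▹ B))
  ∃F τ p B = ne bo (lc (ex τ p) ∙ (ε ▹ B))

  ∇F : ∀ {Γ} (k : ℕ) → Nf Γ (nomT k ⇒ o) → Fm Γ
  ∇F k B = ne bo (lc (nab k) ∙ (ε ▹ B))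

  eqF : ∀ {Γ} (τ : Ty) → T (noO τ) → Nf Γ τ → Nf Γ τ → Fm Γ
  eqF τ p s t = ne bo (lc (eq τ p) ∙ (ε ▹ s ▹ t))

  natF : ∀ {Γ} → Nf Γ nt → Fm Γ
  natF I = ne bo (lc natc ∙ (ε ▹ I))

  zF : ∀ {Γ} → Nf Γ nt
  zF = ne bnt (lc zc ∙ ε)

  sF : ∀ {Γ} → Nf Γ nt → Nf Γ nt
  sF I = ne bnt (lc sc ∙ (ε ▹ I))

  atomF : ∀ {Γ} (p : Pred) → Sp Γ (predTy p) o → Fm Γ
  atomF p s = ne bo (pc p ∙ s)

  module Level (level : Pred → ℕ) where
    lvlH : ∀ {Γ τ} → Head Γ τ → ℕ
    lvlH (pc q) = level q
    lvlH _      = 0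

    lvlNf : ∀ {Γ τ} → Nf Γ τ → ℕ
    lvlNe : ∀ {Γ τ} → Ne Γ τ → ℕ
    lvlSp : ∀ {Γ σ τ} → Sp Γ σ τ → ℕ
    lvlNf (lam t)  = lvlNf t
    lvlNf (ne b n) = lvlNe n
    lvlNe (lc imp ∙ (ε ▹ B ▹ C)) = suc (lvlNf B) ⊔ lvlNf C
    lvlNe (h ∙ s)                = lvlH h ⊔ lvlSp s
    lvlSp ε       = 0
    lvlSp (s ▹ u) = lvlSp s ⊔ lvlNf u

  -- A definition: for each predicate p a clause  ∀x⃗. p x⃗ ≜ B,
  -- represented by the closed term λx⃗.B.
  record Defn : Set where
    field
      level     : Pred → ℕ
      body      : (p : Pred) → Nf [] (predTy p)
      bodyNoNom : ∀ p → NoNom (body p)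
      strat     : ∀ p → Level.lvlNf level (body p) ≤ level p

module Logic (S : Sig) (D : Terms.Defn S) where
  open Sig S
  open Terms S
  open Defn D

  infix 3 _⨾_⊢_

  data _⨾_⊢_ : (Sg : Ctx) → List (Fm Sg) → Fm Sg → Set where
    idπ  : ∀ {Sg Γ Γ' B B'} (π π' : Perm) → Γ ↭ (B ∷ Γ') → π · B ≡ π' · B' →
           Sg ⨾ Γ ⊢ B'
    mc   : ∀ {Sg Γ Γc C} (n : ℕ) (B : Fin n → Fm Sg) (Δ : Fin n → List (Fm Sg)) →
           ((i : Fin n) → Sg ⨾ Δ i ⊢ B i) →
           Sg ⨾ VF.toList B ++ Γ ⊢ C →
           Γc ↭ (concat (VF.toList Δ) ++ Γ) →
           Sg ⨾ Γc ⊢ C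
    cL   : ∀ {Sg Γ Γ' B C} → Γ ↭ (B ∷ Γ') → Sg ⨾ B ∷ B ∷ Γ' ⊢ C → Sg ⨾ Γ ⊢ C
    ⊥L   : ∀ {Sg Γ Γ' C} → Γ ↭ (⊥F ∷ Γ') → Sg ⨾ Γ ⊢ C
    ⊤R   : ∀ {Sg Γ} → Sg ⨾ Γ ⊢ ⊤F
    ∧L₁  : ∀ {Sg Γ Γ' B B' C} → Γ ↭ ((B ∧F B') ∷ Γ') → Sg ⨾ B ∷ Γ' ⊢ C → Sg ⨾ Γ ⊢ C
    ∧L₂  : ∀ {Sg Γ Γ' B B' C} → Γ ↭ ((B ∧F B') ∷ Γ') → Sg ⨾ B' ∷ Γ' ⊢ C → Sg ⨾ Γ ⊢ C
    ∧R   : ∀ {Sg Γ B C} → Sg ⨾ Γ ⊢ B → Sg ⨾ Γ ⊢ C → Sg ⨾ Γ ⊢ B ∧F C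
    ∨L   : ∀ {Sg Γ Γ' B B' C} → Γ ↭ ((B ∨F B') ∷ Γ') →
           Sg ⨾ B ∷ Γ' ⊢ C → Sg ⨾ B' ∷ Γ' ⊢ C → Sg ⨾ Γ ⊢ C
    ∨R₁  : ∀ {Sg Γ B C} → Sg ⨾ Γ ⊢ B → Sg ⨾ Γ ⊢ B ∨F C
    ∨R₂  : ∀ {Sg Γ B C} → Sg ⨾ Γ ⊢ C → Sg ⨾ Γ ⊢ B ∨F C
    ⊃L   : ∀ {Sg Γ Γ' B B' C} → Γ ↭ ((B ⊃F B') ∷ Γ') →
           Sg ⨾ Γ' ⊢ B → Sg ⨾ B' ∷ Γ' ⊢ C → Sg ⨾ Γ ⊢ C
    ⊃R   : ∀ {Sg Γ B C} → Sg ⨾ B ∷ Γ ⊢ C → Sg ⨾ Γ ⊢ B ⊃F C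
    ∀L   : ∀ {Sg Γ Γ' τ p B C} (t : Nf Sg τ) → Γ ↭ (∀F τ p B ∷ Γ') →
           Sg ⨾ napp B t ∷ Γ' ⊢ C → Sg ⨾ Γ ⊢ C
    ∀R   : ∀ {Sg Γ τ p B} (cs : List NomC) → Lists cs B →
           (raise cs τ ∷ Sg) ⨾ map wk Γ ⊢ napp (wk B) (hApp τ cs) →
           Sg ⨾ Γ ⊢ ∀F τ p B
    ∃L   : ∀ {Sg Γ Γ' τ p B C} (cs : List NomC) → Lists cs B → Γ ↭ (∃F τ p B ∷ Γ') →
           (raise cs τ ∷ Sg) ⨾ napp (wk B) (hApp τ cs) ∷ map wk Γ' ⊢ wk C →
           Sg ⨾ Γ ⊢ C
    ∃R   : ∀ {Sg Γ τ p B} (t : Nf Sg τ) → Sg ⨾ Γ ⊢ napp B t → Sg ⨾ Γ ⊢ ∃F τ p B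
    ∇L   : ∀ {Sg Γ Γ' k B C} (a : ℕ) → ¬ ((k , a) ∈supp B) → Γ ↭ (∇F k B ∷ Γ') →
           Sg ⨾ napp B (nmNf (k , a)) ∷ Γ' ⊢ C → Sg ⨾ Γ ⊢ C
    ∇R   : ∀ {Sg Γ k B} (a : ℕ) → ¬ ((k , a) ∈supp B) →
           Sg ⨾ Γ ⊢ napp B (nmNf (k , a)) → Sg ⨾ Γ ⊢ ∇F k B
    eqR  : ∀ {Sg Γ τ p t} → Sg ⨾ Γ ⊢ eqF τ p t t
    eqL  : ∀ {Sg Γ Γ' τ p s t C} (cs : List NomC) → Lists cs (eqF τ p s t) →
           Γ ↭ (eqF τ p s t ∷ Γ') →
           ((Sg' : Ctx) (θ : Subst Sg Sg') → NoNomSub θ →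
              sub (abs cs s) θ ≡ sub (abs cs t) θ →
              Sg' ⨾ map (λ B → sub B θ) Γ' ⊢ sub C θ) →
           Sg ⨾ Γ ⊢ C
    defL : ∀ {Sg Γ Γ' C} (q : Pred) (s : Sp Sg (predTy q) o) → Γ ↭ (atomF q s ∷ Γ') →
           Sg ⨾ appSp (wk0 (body q)) s ∷ Γ' ⊢ C → Sg ⨾ Γ ⊢ C
    defR : ∀ {Sg Γ} (q : Pred) (s : Sp Sg (predTy q) o) →
           Sg ⨾ Γ ⊢ appSp (wk0 (body q)) s → Sg ⨾ Γ ⊢ atomF q s
    natRz : ∀ {Sg Γ} → Sg ⨾ Γ ⊢ natF zF
    natRs : ∀ {Sg Γ I} → Sg ⨾ Γ ⊢ natF I → Sg ⨾ Γ ⊢ natF (sF I)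
    natL : ∀ {Sg Γ Γ' I C} (Dn : Nf [] (nt ⇒ o)) → Γ ↭ (natF I ∷ Γ') →
           [] ⨾ [] ⊢ napp Dn zF →
           (nt ∷ []) ⨾ napp (wk Dn) (ne bnt (var here ∙ ε)) ∷ []
                     ⊢ napp (wk Dn) (sF (ne bnt (var here ∙ ε))) →
           Sg ⨾ napp (wk0 Dn) I ∷ Γ' ⊢ C →
           Sg ⨾ Γ ⊢ C

  ht : ∀ {Sg Γ C} → Sg ⨾ Γ ⊢ C → Ord
  ht (idπ _ _ _ _)        = node ⊥ (λ ())
  ht (mc n B Δ Πs Π _)    = node (Fin n ⊎ ⊤) λ { (inj₁ i) → ht (Πs i) ; (inj₂ _) → ht Π }
  ht (cL _ Π)             = node ⊤ λ _ → ht Π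
  ht (⊥L _)               = node ⊥ (λ ())
  ht ⊤R                   = node ⊥ (λ ())
  ht (∧L₁ _ Π)            = node ⊤ λ _ → ht Π
  ht (∧L₂ _ Π)            = node ⊤ λ _ → ht Π
  ht (∧R Π Π')            = node Bool λ { true → ht Π ; false → ht Π' }
  ht (∨L _ Π Π')          = node Bool λ { true → ht Π ; false → ht Π' }
  ht (∨R₁ Π)              = node ⊤ λ _ → ht Π
  ht (∨R₂ Π)              = node ⊤ λ _ → ht Π
  ht (⊃L _ Π Π')          = node Bool λ { true → ht Π ; false → ht Π' }
  ht (⊃R Π)               = node ⊤ λ _ → ht Π
  ht (∀L _ _ Π)           = node ⊤ λ _ → ht Π
  ht (∀R _ _ Π)           = node ⊤ λ _ → ht Π
  ht (∃L _ _ _ Π)         = node ⊤ λ _ → ht Π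
  ht (∃R _ Π)             = node ⊤ λ _ → ht Π
  ht (∇L _ _ _ Π)         = node ⊤ λ _ → ht Π
  ht (∇R _ _ Π)           = node ⊤ λ _ → ht Π
  ht eqR                  = node ⊥ (λ ())
  ht (eqL {Sg = Sg} {s = s} {t = t} cs _ _ Πs) =
    node (Σ Ctx λ Sg' → Σ (Subst Sg Sg') λ θ →
            NoNomSub θ × (sub (abs cs s) θ ≡ sub (abs cs t) θ))
         λ { (Sg' , θ , nn , e) → ht (Πs Sg' θ nn e) }
  ht (defL _ _ _ Π)       = node ⊤ λ _ → ht Π
  ht (defR _ _ Π)         = node ⊤ λ _ → ht Π
  ht natRz                = node ⊥ (λ ())
  ht (natRs Π)            = node ⊤ λ _ → ht Π
  ht (natL _ _ Π₁ Π₂ Π₃)  = node (Fin 3) λ { Fin.zero → ht Π₁ ; (Fin.suc Fin.zero) → ht Π₂ ; _ → ht Π₃ }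

  PermutationLemma : Set
  PermutationLemma =
    ∀ {Sg : Ctx} {n : ℕ} (Bs : Fin n → Fm Sg) (B₀ : Fm Sg)
      (π₀ : Perm) (πs : Fin n → Perm) →
      (Π : Sg ⨾ VF.toList Bs ⊢ B₀) →
      Σ (Sg ⨾ VF.toList (λ i → πs i · Bs i) ⊢ π₀ · B₀) (λ Π′ → ht Π′ ≤o ht Π)

module Submission where

-- Every rule of LG^ω is equivariant: applying a permutation of nominal constants to an instance
-- of a rule yields an instance of the same rule, because βη-normalisation, abstraction over
-- nominal constants, support listings and freshness conditions commute with permutations, while
-- definition bodies and Σ-substitutions contain no nominal constants at all. The induction on Π
-- is strengthened so that each hypothesis carries its own permutation: a left rule propagates the
-- permutation of its principal formula to the formulas it introduces, cut formulas stay
-- unpermuted, and the identity rule absorbs the mismatch through its two permutations. The new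
-- proof mirrors Π rule by rule, so its height is no larger.

open import Defs
open import Data.Nat using (ℕ; zero; suc; _≤_; _⊔_; _≟_)
open import Data.Nat.Properties using (≤-trans; m≤m⊔n; m≤n⊔m)
open import Data.Bool using (true; false)
open import Data.Unit using (tt)
open import Data.Empty using (⊥-elim)
open import Data.Product using (Σ; ∃; ∃₂; _×_; _,_; proj₁; proj₂)
open import Data.Sum using (_⊎_; inj₁; inj₂)
import Data.Sum as Sum
open import Data.List using (List; []; _∷_; map; _++_; concat)
open import Data.List.Properties using (map-id)
open import Data.List.Relation.Binary.Pointwise using (Pointwise; []; _∷_; tabulate⁺)
import Data.List.Relation.Binary.Pointwise as Pointwise
open import Data.List.Relation.Binary.Permutation.Propositional using (_↭_; prep; swap; ↭-refl; ↭-trans)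
import Data.List.Relation.Binary.Permutation.Propositional as ↭
import Data.List.Relation.Binary.Permutation.Propositional.Properties as ↭
open import Data.List.Membership.Propositional using (_∈_)
open import Data.List.Membership.Propositional.Properties using (∈-map⁺; ∈-map⁻)
import Data.List.Relation.Unary.Unique.Propositional.Properties as Unique
open import Data.Fin using (Fin)
import Data.Fin as Fin
import Data.Vec.Functional as VF
open import Relation.Nullary using (¬_; yes; no)
open import Relation.Binary.PropositionalEquality
  using (_≡_; refl; sym; trans; cong; cong₂; subst; module ≡-Reasoning)

module _ {A B : Set} {R : A → B → Set} where

  Pointwise-↭ : ∀ {Θ Γ Γ′} → Pointwise R Θ Γ → Γ ↭ Γ′ →
                ∃ λ Θ′ → Θ ↭ Θ′ × Pointwise R Θ′ Γ′
  Pointwise-↭ p ↭.refl = _ , ↭-refl , p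
  Pointwise-↭ (r ∷ p) (prep x q) with Pointwise-↭ p q
  ... | _ , q′ , p′ = _ , prep _ q′ , r ∷ p′
  Pointwise-↭ (r₁ ∷ r₂ ∷ p) (swap x y q) with Pointwise-↭ p q
  ... | _ , q′ , p′ = _ , swap _ _ q′ , r₂ ∷ r₁ ∷ p′
  Pointwise-↭ p (↭.trans q₁ q₂) with Pointwise-↭ p q₁
  ... | _ , q₁′ , p₁ with Pointwise-↭ p₁ q₂
  ... | _ , q₂′ , p₂ = _ , ↭-trans q₁′ q₂′ , p₂

  Pointwise-++⁻ : ∀ X {Y Θ} → Pointwise R Θ (X ++ Y) →
                  ∃₂ λ Θ₁ Θ₂ → Θ ≡ Θ₁ ++ Θ₂ × Pointwise R Θ₁ X × Pointwise R Θ₂ Y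
  Pointwise-++⁻ []      p       = [] , _ , refl , [] , p
  Pointwise-++⁻ (x ∷ X) (r ∷ p) with Pointwise-++⁻ X p
  ... | Θ₁ , Θ₂ , refl , p₁ , p₂ = _ ∷ Θ₁ , Θ₂ , refl , r ∷ p₁ , p₂

  Pointwise-concat⁻ : ∀ n (Xs : Fin n → List B) {Θ} → Pointwise R Θ (concat (VF.toList Xs)) →
                      ∃ λ (Θs : Fin n → List A) →
                        Θ ≡ concat (VF.toList Θs) × (∀ i → Pointwise R (Θs i) (Xs i))
  Pointwise-concat⁻ zero    Xs [] = (λ ()) , refl , λ ()
  Pointwise-concat⁻ (suc n) Xs p with Pointwise-++⁻ (Xs Fin.zero) p
  ... | Θ₁ , _ , refl , p₁ , p₂ with Pointwise-concat⁻ n (λ i → Xs (Fin.suc i)) p₂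
  ... | Θs , refl , ps =
    (λ { Fin.zero → Θ₁ ; (Fin.suc i) → Θs i }) , refl , λ { Fin.zero → p₁ ; (Fin.suc i) → ps i }

module PermutationAction (S : Sig) where
  open Sig S
  open Terms S
  open Perm

  private variable
    Γ Δ : Ctx
    α τ : Ty

  idₚ : Perm
  idₚ = record { fun = λ _ i → i ; inv = λ _ i → i ; fi = λ _ _ → refl ; if = λ _ _ → refl
               ; bound = 0 ; fin = λ _ _ _ → refl }

  _∘ₚ_ : Perm → Perm → Perm
  ρ ∘ₚ σ = record
    { fun   = λ k i → fun ρ k (fun σ k i)
    ; inv   = λ k i → inv σ k (inv ρ k i)
    ; fi    = λ k i → trans (cong (fun ρ k) (fi σ k (inv ρ k i))) (fi ρ k i)
    ; if    = λ k i → trans (cong (inv σ k) (if ρ k (fun σ k i))) (if σ k i)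
    ; bound = bound ρ ⊔ bound σ
    ; fin   = λ k i b → trans (cong (fun ρ k) (fin σ k i (lower (m≤n⊔m (bound ρ) (bound σ)) b)))
                              (fin ρ k i (lower (m≤m⊔n (bound ρ) (bound σ)) b))
    }
    where
    lower : ∀ {b b′ k i} → b ≤ b′ → b′ ≤ k ⊎ b′ ≤ i → b ≤ k ⊎ b ≤ i
    lower b≤b′ = Sum.map (≤-trans b≤b′) (≤-trans b≤b′)

  invₚ : Perm → Perm
  invₚ σ = record
    { fun = inv σ ; inv = fun σ ; fi = if σ ; if = fi σ ; bound = bound σ
    ; fin = λ k i b → trans (cong (inv σ k) (sym (fin σ k i b))) (if σ k i)
    }

  fun-injective : (π : Perm) {k i j : ℕ} → fun π k i ≡ fun π k j → i ≡ j
  fun-injective π {k} {i} {j} e = trans (sym (if π k i)) (trans (cong (inv π k) e) (if π k j))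

  _·ᶜ_ : Perm → NomC → NomC
  π ·ᶜ (k , i) = k , fun π k i

  ·ᶜ-injective : (π : Perm) {a b : NomC} → π ·ᶜ a ≡ π ·ᶜ b → a ≡ b
  ·ᶜ-injective π {k , i} {k′ , j} e with cong proj₁ e
  ... | refl = cong (k ,_) (fun-injective π (cong proj₂ e))

  permNe : Perm → Ne Γ τ → Ne Γ τ
  permNe π (h ∙ s) = permH π h ∙ permSp π s

  ·ᴴ-∘ : (ρ σ : Perm) (h : Head Γ τ) → permH (ρ ∘ₚ σ) h ≡ permH ρ (permH σ h)
  ·ᴴ-∘ ρ σ (var x)  = refl
  ·ᴴ-∘ ρ σ (nm k i) = refl
  ·ᴴ-∘ ρ σ (con c)  = refl
  ·ᴴ-∘ ρ σ (pc p)   = refl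
  ·ᴴ-∘ ρ σ (lc l)   = refl

  ·-∘  : (ρ σ : Perm) (t : Nf Γ τ) → (ρ ∘ₚ σ) · t ≡ ρ · σ · t
  ·ˢ-∘ : (ρ σ : Perm) (s : Sp Γ α τ) → permSp (ρ ∘ₚ σ) s ≡ permSp ρ (permSp σ s)
  ·-∘ ρ σ (lam t)        = cong lam (·-∘ ρ σ t)
  ·-∘ ρ σ (ne b (h ∙ s)) = cong₂ (λ h′ s′ → ne b (h′ ∙ s′)) (·ᴴ-∘ ρ σ h) (·ˢ-∘ ρ σ s)
  ·ˢ-∘ ρ σ ε       = refl
  ·ˢ-∘ ρ σ (s ▹ u) = cong₂ _▹_ (·ˢ-∘ ρ σ s) (·-∘ ρ σ u)

  ·ᴴ-fix : (π : Perm) (h : Head Γ τ) → (∀ c → occH c h → π ·ᶜ c ≡ c) → permH π h ≡ h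
  ·ᴴ-fix π (var x)  fix = refl
  ·ᴴ-fix π (nm k i) fix = cong (nm k) (cong proj₂ (fix (k , i) refl))
  ·ᴴ-fix π (con c)  fix = refl
  ·ᴴ-fix π (pc p)   fix = refl
  ·ᴴ-fix π (lc l)   fix = refl

  ·-fix  : (π : Perm) (t : Nf Γ τ) → (∀ c → c ∈supp t → π ·ᶜ c ≡ c) → π · t ≡ t
  ·ˢ-fix : (π : Perm) (s : Sp Γ α τ) → (∀ c → occSp c s → π ·ᶜ c ≡ c) → permSp π s ≡ s
  ·-fix π (lam t)        fix = cong lam (·-fix π t fix)
  ·-fix π (ne b (h ∙ s)) fix =
    cong₂ (λ h′ s′ → ne b (h′ ∙ s′)) (·ᴴ-fix π h (λ c occ → fix c (inj₁ occ))) (·ˢ-fix π s (λ c occ → fix c (inj₂ occ)))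
  ·ˢ-fix π ε       fix = refl
  ·ˢ-fix π (s ▹ u) fix = cong₂ _▹_ (·ˢ-fix π s (λ c occ → fix c (inj₁ occ))) (·-fix π u (λ c occ → fix c (inj₂ occ)))

  ·-identity : (t : Nf Γ τ) → idₚ · t ≡ t
  ·-identity t = ·-fix idₚ t (λ _ _ → refl)

  ·-fresh : (π : Perm) (t : Nf Γ τ) → NoNom t → π · t ≡ t
  ·-fresh π t fresh = ·-fix π t (λ c occ → ⊥-elim (fresh c occ))

  ·-inverseˡ : (σ : Perm) (t : Nf Γ τ) → invₚ σ · σ · t ≡ t
  ·-inverseˡ σ t =
    trans (sym (·-∘ (invₚ σ) σ t)) (·-fix (invₚ σ ∘ₚ σ) t (λ c _ → cong (proj₁ c ,_) (if σ (proj₁ c) (proj₂ c))))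

  ·-injective : (σ : Perm) {t u : Nf Γ τ} → σ · t ≡ σ · u → t ≡ u
  ·-injective σ {t} {u} e = trans (sym (·-inverseˡ σ t)) (trans (cong (invₚ σ ·_) e) (·-inverseˡ σ u))

  ·-cancelʳ : (π σ : Perm) (t : Nf Γ τ) → (π ∘ₚ invₚ σ) · σ · t ≡ π · t
  ·-cancelʳ π σ t = trans (·-∘ π (invₚ σ) (σ · t)) (cong (π ·_) (·-inverseˡ σ t))

  ·ᴴ-ren : (π : Perm) (ρ : Ren Γ Δ) (h : Head Γ τ) → permH π (renH ρ h) ≡ renH ρ (permH π h)
  ·ᴴ-ren π ρ (var x)  = refl
  ·ᴴ-ren π ρ (nm k i) = refl
  ·ᴴ-ren π ρ (con c)  = refl
  ·ᴴ-ren π ρ (pc p)   = refl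
  ·ᴴ-ren π ρ (lc l)   = refl

  ·-ren  : (π : Perm) (ρ : Ren Γ Δ) (t : Nf Γ τ) → π · renNf ρ t ≡ renNf ρ (π · t)
  ·ˢ-ren : (π : Perm) (ρ : Ren Γ Δ) (s : Sp Γ α τ) → permSp π (renSp ρ s) ≡ renSp ρ (permSp π s)
  ·-ren π ρ (lam t)        = cong lam (·-ren π (extR ρ) t)
  ·-ren π ρ (ne b (h ∙ s)) = cong₂ (λ h′ s′ → ne b (h′ ∙ s′)) (·ᴴ-ren π ρ h) (·ˢ-ren π ρ s)
  ·ˢ-ren π ρ ε       = refl
  ·ˢ-ren π ρ (s ▹ u) = cong₂ _▹_ (·ˢ-ren π ρ s) (·-ren π ρ u)

  ·ᴺ-ren : (π : Perm) (ρ : Ren Γ Δ) (n : Ne Γ τ) → permNe π (renNe ρ n) ≡ renNe ρ (permNe π n)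
  ·ᴺ-ren π ρ (h ∙ s) = cong₂ _∙_ (·ᴴ-ren π ρ h) (·ˢ-ren π ρ s)

  -- Kripke logical relation "w is the π-image of v" on semantic values; it makes evaluation,
  -- and hence hereditary substitution, commute with π.
  module _ (π : Perm) where
    Permuted : ∀ τ → Sem Γ τ → Sem Γ τ → Set
    Permuted o        v w = w ≡ permNe π v
    Permuted (nomT k) v w = w ≡ permNe π v
    Permuted (base k) v w = w ≡ permNe π v
    Permuted nt       v w = w ≡ permNe π v
    Permuted {Γ} (α ⇒ τ) f g =
      ∀ {Δ} (ρ : Ren Γ Δ) a b → Permuted α a b → Permuted τ (f ρ a) (g ρ b)

    PermutedEnv : Env Γ Δ → Env Γ Δ → Set
    PermutedEnv {Γ} η η′ = ∀ {τ} (x : Γ ∋ τ) → Permuted τ (η x) (η′ x)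

    permuted-ren : ∀ τ (ρ : Ren Γ Δ) {v w} → Permuted τ v w → Permuted τ (renSem τ ρ v) (renSem τ ρ w)
    permuted-ren o        ρ {v} e = trans (cong (renNe ρ) e) (sym (·ᴺ-ren π ρ v))
    permuted-ren (nomT k) ρ {v} e = trans (cong (renNe ρ) e) (sym (·ᴺ-ren π ρ v))
    permuted-ren (base k) ρ {v} e = trans (cong (renNe ρ) e) (sym (·ᴺ-ren π ρ v))
    permuted-ren nt       ρ {v} e = trans (cong (renNe ρ) e) (sym (·ᴺ-ren π ρ v))
    permuted-ren (α ⇒ τ)  ρ r     = λ ρ′ → r (λ x → ρ′ (ρ x))

    permuted-reflect : ∀ τ (n n′ : Ne Γ τ) → n′ ≡ permNe π n → Permuted τ (reflect τ n) (reflect τ n′)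
    permuted-reify   : ∀ τ {v w : Sem Γ τ} → Permuted τ v w → reify τ w ≡ π · reify τ v
    permuted-reflect o        n n′ e = e
    permuted-reflect (nomT k) n n′ e = e
    permuted-reflect (base k) n n′ e = e
    permuted-reflect nt       n n′ e = e
    permuted-reflect (α ⇒ τ) (h ∙ s) _ refl ρ a b r =
      permuted-reflect τ _ _ (cong₂ _∙_ (sym (·ᴴ-ren π ρ h)) (cong₂ _▹_ (sym (·ˢ-ren π ρ s)) (permuted-reify α r)))
    permuted-reify o        {h ∙ s} e = cong (ne bo) e
    permuted-reify (nomT k) {h ∙ s} e = cong (ne (bnom k)) e
    permuted-reify (base k) {h ∙ s} e = cong (ne (bbase k)) e
    permuted-reify nt       {h ∙ s} e = cong (ne bnt) e
    permuted-reify (α ⇒ τ) r = cong lam (permuted-reify τ (r there _ _ (permuted-reflect α _ _ refl)))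

    permuted-idEnv : PermutedEnv {Γ} idEnv idEnv
    permuted-idEnv {τ = τ} x = permuted-reflect τ _ _ refl

    permuted-evalH : {η η′ : Env Γ Δ} (h : Head Γ τ) → PermutedEnv η η′ →
                     Permuted τ (evalH h η) (evalH (permH π h) η′)
    permuted-evalH (var x)    r = r x
    permuted-evalH (nm k i)   r = refl
    permuted-evalH (con c)    r = permuted-reflect (conTy c) _ _ refl
    permuted-evalH (pc p)     r = permuted-reflect (predTy p) _ _ refl
    permuted-evalH (lc {τ} l) r = permuted-reflect τ _ _ refl

    permuted-eval   : {η η′ : Env Γ Δ} (t : Nf Γ τ) → PermutedEnv η η′ →
                      Permuted τ (eval t η) (eval (π · t) η′)
    permuted-evalSp : {η η′ : Env Γ Δ} (s : Sp Γ α τ) {v w : Sem Δ α} → Permuted α v w →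
                      PermutedEnv η η′ → Permuted τ (evalSp s v η) (evalSp (permSp π s) w η′)
    permuted-eval {η = η} {η′} (lam {α} t) r ρ a b r′ = permuted-eval t extended
      where
      extended : PermutedEnv (extE (λ {τ} x → renSem τ ρ (η x)) a) (extE (λ {τ} x → renSem τ ρ (η′ x)) b)
      extended here      = r′
      extended (there x) = permuted-ren _ ρ (r x)
    permuted-eval (ne b (h ∙ s)) r = permuted-evalSp s (permuted-evalH h r) r
    permuted-evalSp ε       r′ r = r′
    permuted-evalSp (s ▹ u) r′ r = permuted-evalSp s r′ r (λ x → x) _ _ (permuted-eval u r)

  ·-napp : (π : Perm) (t : Nf Γ (α ⇒ τ)) (u : Nf Γ α) → π · napp t u ≡ napp (π · t) (π · u)
  ·-napp {τ = τ} π t u =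
    sym (permuted-reify π τ (permuted-eval π t (permuted-idEnv π) (λ x → x) _ _ (permuted-eval π u (permuted-idEnv π))))

  ·-appSp : (π : Perm) (t : Nf Γ α) (s : Sp Γ α τ) → π · appSp t s ≡ appSp (π · t) (permSp π s)
  ·-appSp {τ = τ} π t s =
    sym (permuted-reify π τ (permuted-evalSp π s (permuted-eval π t (permuted-idEnv π)) (permuted-idEnv π)))

  ·-sub : (π : Perm) (t : Nf Γ τ) (θ : Subst Γ Δ) → NoNomSub θ → π · sub t θ ≡ sub (π · t) θ
  ·-sub {τ = τ} π t θ fresh = sym (permuted-reify π τ (permuted-eval π t θ-permuted))
    where
    θ-permuted : PermutedEnv π (λ x → eval (θ x) idEnv) (λ x → eval (θ x) idEnv)
    θ-permuted x = subst (λ u → Permuted π _ (eval (θ x) idEnv) (eval u idEnv))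
                         (·-fresh π (θ x) (fresh x)) (permuted-eval π (θ x) (permuted-idEnv π))

  ·-reify-reflect : ∀ τ (π : Perm) (n : Ne Γ τ) → π · reify τ (reflect τ n) ≡ reify τ (reflect τ (permNe π n))
  ·-reify-reflect τ π n = sym (permuted-reify π τ (permuted-reflect π τ n _ refl))

  occH-·⁺ : (π : Perm) {c : NomC} (h : Head Γ τ) → occH c h → occH (π ·ᶜ c) (permH π h)
  occH-·⁺ π (nm k i) refl = refl

  ∈supp-·⁺ : (π : Perm) {c : NomC} (t : Nf Γ τ) → c ∈supp t → (π ·ᶜ c) ∈supp (π · t)
  occSp-·⁺ : (π : Perm) {c : NomC} (s : Sp Γ α τ) → occSp c s → occSp (π ·ᶜ c) (permSp π s)
  ∈supp-·⁺ π (lam t)        occ        = ∈supp-·⁺ π t occ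
  ∈supp-·⁺ π (ne b (h ∙ s)) (inj₁ occ) = inj₁ (occH-·⁺ π h occ)
  ∈supp-·⁺ π (ne b (h ∙ s)) (inj₂ occ) = inj₂ (occSp-·⁺ π s occ)
  occSp-·⁺ π (s ▹ u) (inj₁ occ) = inj₁ (occSp-·⁺ π s occ)
  occSp-·⁺ π (s ▹ u) (inj₂ occ) = inj₂ (∈supp-·⁺ π u occ)

  occH-·⁻ : (π : Perm) {c : NomC} (h : Head Γ τ) → occH c (permH π h) → ∃ λ c′ → occH c′ h × c ≡ π ·ᶜ c′
  occH-·⁻ π (nm k i) occ = (k , i) , refl , occ

  ∈supp-·⁻ : (π : Perm) {c : NomC} (t : Nf Γ τ) → c ∈supp (π · t) → ∃ λ c′ → c′ ∈supp t × c ≡ π ·ᶜ c′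
  occSp-·⁻ : (π : Perm) {c : NomC} (s : Sp Γ α τ) → occSp c (permSp π s) → ∃ λ c′ → occSp c′ s × c ≡ π ·ᶜ c′
  ∈supp-·⁻ π (lam t) occ = ∈supp-·⁻ π t occ
  ∈supp-·⁻ π (ne b (h ∙ s)) (inj₁ occ) with occH-·⁻ π h occ
  ... | c′ , occ′ , e = c′ , inj₁ occ′ , e
  ∈supp-·⁻ π (ne b (h ∙ s)) (inj₂ occ) with occSp-·⁻ π s occ
  ... | c′ , occ′ , e = c′ , inj₂ occ′ , e
  occSp-·⁻ π (s ▹ u) (inj₁ occ) with occSp-·⁻ π s occ
  ... | c′ , occ′ , e = c′ , inj₁ occ′ , e
  occSp-·⁻ π (s ▹ u) (inj₂ occ) with ∈supp-·⁻ π u occ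
  ... | c′ , occ′ , e = c′ , inj₂ occ′ , e

  ∉supp-· : (π : Perm) (t : Nf Γ τ) {c : NomC} → ¬ c ∈supp t → ¬ (π ·ᶜ c) ∈supp (π · t)
  ∉supp-· π t c∉t occ with ∈supp-·⁻ π t occ
  ... | c′ , occ′ , e with ·ᶜ-injective π e
  ... | refl = c∉t occ′

  Lists-· : (π : Perm) (cs : List NomC) (t : Nf Γ τ) → Lists cs t → Lists (map (π ·ᶜ_) cs) (π · t)
  Lists-· π cs t (unique , lists) = Unique.map⁺ (·ᶜ-injective π) unique , λ c → listed c , complete c
    where
    listed : ∀ c → c ∈ map (π ·ᶜ_) cs → c ∈supp (π · t)
    listed c m with ∈-map⁻ (π ·ᶜ_) m
    ... | c′ , m′ , refl = ∈supp-·⁺ π t (proj₁ (lists c′) m′)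
    complete : ∀ c → c ∈supp (π · t) → c ∈ map (π ·ᶜ_) cs
    complete c occ with ∈supp-·⁻ π t occ
    ... | c′ , occ′ , refl = ∈-map⁺ (π ·ᶜ_) (proj₂ (lists c′) occ′)

  ·-wk : (π : Perm) (t : Nf Γ τ) → π · wk {σ = α} t ≡ wk (π · t)
  ·-wk π = ·-ren π there

  ·-wk0-fresh : (π : Perm) (t : Nf [] τ) → NoNom t → π · wk0 {Γ} t ≡ wk0 t
  ·-wk0-fresh π t fresh = trans (·-ren π _ t) (cong (renNf _) (·-fresh π t fresh))

  ·ᴴ-bind : (π : Perm) (c : NomC) (h : Head Γ τ) → permH π (bindH c h) ≡ bindH (π ·ᶜ c) (permH π h)
  ·ᴴ-bind π c (var x) = refl
  ·ᴴ-bind π c (con d) = refl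
  ·ᴴ-bind π c (pc p)  = refl
  ·ᴴ-bind π c (lc l)  = refl
  ·ᴴ-bind π (k′ , i′) (nm k i) with k ≟ k′ | i ≟ i′ | fun π k i ≟ fun π k′ i′
  ... | yes refl | yes refl | yes refl = refl
  ... | yes refl | yes refl | no  πi≢πi = ⊥-elim (πi≢πi refl)
  ... | yes refl | no  i≢i′ | yes πi≡πi′ = ⊥-elim (i≢i′ (fun-injective π πi≡πi′))
  ... | yes refl | no  _    | no  _    = refl
  ... | no  _    | _        | _        = refl

  ·-bind  : (π : Perm) (c : NomC) (t : Nf Γ τ) → π · bindNf c t ≡ bindNf (π ·ᶜ c) (π · t)
  ·ˢ-bind : (π : Perm) (c : NomC) (s : Sp Γ α τ) → permSp π (bindSp c s) ≡ bindSp (π ·ᶜ c) (permSp π s)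
  ·-bind π c (lam t)        = cong lam (trans (·-ren π _ (bindNf c t)) (cong (renNf _) (·-bind π c t)))
  ·-bind π c (ne b (h ∙ s)) = cong₂ (λ h′ s′ → ne b (h′ ∙ s′)) (·ᴴ-bind π c h) (·ˢ-bind π c s)
  ·ˢ-bind π c ε       = refl
  ·ˢ-bind π c (s ▹ u) = cong₂ _▹_ (·ˢ-bind π c s) (·-bind π c u)

  raise-·ᶜ : (π : Perm) (cs : List NomC) (τ : Ty) → raise cs τ ≡ raise (map (π ·ᶜ_) cs) τ
  raise-·ᶜ π []       τ = refl
  raise-·ᶜ π (c ∷ cs) τ = cong (nomT (proj₁ c) ⇒_) (raise-·ᶜ π cs τ)

  castNf : ∀ {A B} → A ≡ B → Nf Γ A → Nf Γ B
  castNf = subst (Nf _)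

  castSp : ∀ {A B} → A ≡ B → Sp Γ α A → Sp Γ α B
  castSp = subst (Sp _ _)

  castEigen : ∀ {A B} → A ≡ B → Nf (A ∷ Γ) τ → Nf (B ∷ Γ) τ
  castEigen {Γ} {τ} = subst (λ A → Nf (A ∷ Γ) τ)

  castNf-lam : ∀ {A B} (e : A ≡ B) (t : Nf (α ∷ Γ) A) → castNf (cong (α ⇒_) e) (lam t) ≡ lam (castNf e t)
  castNf-lam refl t = refl

  castSp-▹ : ∀ {A B} (e : A ≡ B) (s : Sp Γ α (τ ⇒ A)) (u : Nf Γ τ) →
             castSp e (s ▹ u) ≡ castSp (cong (τ ⇒_) e) s ▹ u
  castSp-▹ refl s u = refl

  castEigen-napp-wk : ∀ {A B} (e : A ≡ B) (t : Nf Γ (τ ⇒ o)) (u : Nf (A ∷ Γ) τ) →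
                      castEigen e (napp (wk t) u) ≡ napp (wk t) (castEigen e u)
  castEigen-napp-wk refl t u = refl

  castEigen-wk : ∀ {A B} (e : A ≡ B) (t : Nf Γ τ) → castEigen e (wk t) ≡ wk t
  castEigen-wk refl t = refl

  map-castEigen-wk : ∀ {A B} (e : A ≡ B) (Δ : List (Fm Γ)) → map (castEigen e) (map wk Δ) ≡ map wk Δ
  map-castEigen-wk refl Δ = map-id (map wk Δ)

  sub-castNf : ∀ {A B} (e : A ≡ B) (t : Nf Γ A) (θ : Subst Γ Δ) → sub (castNf e t) θ ≡ castNf e (sub t θ)
  sub-castNf refl t θ = refl

  castNf-injective : ∀ {A B} (e : A ≡ B) {t u : Nf Γ A} → castNf e t ≡ castNf e u → t ≡ u
  castNf-injective refl e = e

  ·-abs : (π : Perm) (cs : List NomC) (t : Nf Γ τ) →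
          castNf (raise-·ᶜ π cs τ) (π · abs cs t) ≡ abs (map (π ·ᶜ_) cs) (π · t)
  ·-abs π []           t = refl
  ·-abs {τ = τ} π (c ∷ cs) t = begin
    castNf (raise-·ᶜ π (c ∷ cs) τ) (lam (π · abs cs (bindNf c t)))
      ≡⟨ castNf-lam (raise-·ᶜ π cs τ) _ ⟩
    lam (castNf (raise-·ᶜ π cs τ) (π · abs cs (bindNf c t)))
      ≡⟨ cong lam (·-abs π cs (bindNf c t)) ⟩
    lam (abs (map (π ·ᶜ_) cs) (π · bindNf c t))
      ≡⟨ cong (λ u → lam (abs (map (π ·ᶜ_) cs) u)) (·-bind π c t) ⟩
    lam (abs (map (π ·ᶜ_) cs) (bindNf (π ·ᶜ c) (π · t)))
      ∎
    where open ≡-Reasoning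

  ·-spineNm : (π : Perm) (cs : List NomC) (s : Sp Γ α (raise cs τ)) →
              permSp π (spineNm cs s) ≡ spineNm (map (π ·ᶜ_) cs) (castSp (raise-·ᶜ π cs τ) (permSp π s))
  ·-spineNm π []       s = refl
  ·-spineNm {τ = τ} π (c ∷ cs) s =
    trans (·-spineNm π cs (s ▹ nmNf c))
          (cong (spineNm (map (π ·ᶜ_) cs)) (castSp-▹ (raise-·ᶜ π cs τ) (permSp π s) (nmNf (π ·ᶜ c))))

  -- stated for an arbitrary e so that it can be proved by matching e with refl
  castEigen-hApp : ∀ {A} τ (cs : List NomC) (e : A ≡ raise cs τ) →
                   castEigen {Γ} e (reify τ (reflect τ (var here ∙ spineNm cs (castSp e ε)))) ≡ hApp τ cs
  castEigen-hApp τ cs refl = refl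

  ·-hApp : ∀ τ (π : Perm) (cs : List NomC) →
           castEigen {Γ} (raise-·ᶜ π cs τ) (π · hApp τ cs) ≡ hApp τ (map (π ·ᶜ_) cs)
  ·-hApp τ π cs =
    trans (cong (castEigen (raise-·ᶜ π cs τ))
                (trans (·-reify-reflect τ π (var here ∙ spineNm cs ε))
                       (cong (λ s → reify τ (reflect τ (var here ∙ s))) (·-spineNm π cs ε))))
          (castEigen-hApp τ (map (π ·ᶜ_) cs) (raise-·ᶜ π cs τ))

  ·-instantiate : ∀ τ (π : Perm) (B : Nf Γ (τ ⇒ o)) (cs : List NomC) →
                  castEigen (raise-·ᶜ π cs τ) (π · napp (wk B) (hApp τ cs))
                    ≡ napp (wk (π · B)) (hApp τ (map (π ·ᶜ_) cs))
  ·-instantiate τ π B cs = begin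
    castEigen e (π · napp (wk B) (hApp τ cs))          ≡⟨ cong (castEigen e) (·-napp π (wk B) (hApp τ cs)) ⟩
    castEigen e (napp (π · wk B) (π · hApp τ cs))      ≡⟨ cong (λ t → castEigen e (napp t (π · hApp τ cs))) (·-wk π B) ⟩
    castEigen e (napp (wk (π · B)) (π · hApp τ cs))    ≡⟨ castEigen-napp-wk e (π · B) (π · hApp τ cs) ⟩
    napp (wk (π · B)) (castEigen e (π · hApp τ cs))    ≡⟨ cong (napp (wk (π · B))) (·-hApp τ π cs) ⟩
    napp (wk (π · B)) (hApp τ (map (π ·ᶜ_) cs))        ∎
    where
    open ≡-Reasoning
    e = raise-·ᶜ π cs τ

  sub-abs-·⁻ : (π : Perm) (cs : List NomC) (s t : Nf Γ τ) (θ : Subst Γ Δ) → NoNomSub θ →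
               sub (abs (map (π ·ᶜ_) cs) (π · s)) θ ≡ sub (abs (map (π ·ᶜ_) cs) (π · t)) θ →
               sub (abs cs s) θ ≡ sub (abs cs t) θ
  sub-abs-·⁻ {τ = τ} π cs s t θ fresh e =
    ·-injective π (castNf-injective (raise-·ᶜ π cs τ) (trans (permuted s) (trans e (sym (permuted t)))))
    where
    permuted : ∀ u → castNf (raise-·ᶜ π cs τ) (π · sub (abs cs u) θ) ≡ sub (abs (map (π ·ᶜ_) cs) (π · u)) θ
    permuted u = trans (cong (castNf (raise-·ᶜ π cs τ)) (·-sub π (abs cs u) θ fresh))
                       (trans (sym (sub-castNf (raise-·ᶜ π cs τ) (π · abs cs u) θ))
                              (cong (λ v → sub v θ) (·-abs π cs u)))

module Equivariance (S : Sig) (D : Terms.Defn S) where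
  open Sig S
  open Terms S
  open Defn D
  open Logic S D
  open PermutationAction S

  private variable
    Sg Sg′ : Ctx
    Γ Γ′ Γ₁ : List (Fm Sg)
    B B′ C C′ : Fm Sg
    a : Ord

  _∼ₚ_ : Fm Sg → Fm Sg → Set
  B′ ∼ₚ B = ∃ λ σ → B′ ≡ σ · B

  _≋ₚ_ : List (Fm Sg) → List (Fm Sg) → Set
  Γ′ ≋ₚ Γ = ∃ λ Θ → Γ′ ↭ Θ × Pointwise _∼ₚ_ Θ Γ

  ∼ₚ-refl : B ∼ₚ B
  ∼ₚ-refl {B = B} = idₚ , sym (·-identity B)

  Pointwise⇒≋ₚ : Pointwise _∼ₚ_ Γ′ Γ → Γ′ ≋ₚ Γ
  Pointwise⇒≋ₚ p = _ , ↭-refl , p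

  ≋ₚ-∷ : B′ ∼ₚ B → Γ′ ≋ₚ Γ → (B′ ∷ Γ′) ≋ₚ (B ∷ Γ)
  ≋ₚ-∷ r (Θ , q , p) = _ , prep _ q , r ∷ p

  ≋ₚ-resp-↭ : Γ′ ≋ₚ Γ → Γ ↭ Γ₁ → Γ′ ≋ₚ Γ₁
  ≋ₚ-resp-↭ (Θ , q , p) r with Pointwise-↭ p r
  ... | Θ′ , q′ , p′ = Θ′ , ↭-trans q q′ , p′

  ≋ₚ-principal : Γ′ ≋ₚ Γ → Γ ↭ (B ∷ Γ₁) → ∃₂ λ σ Δ → Γ′ ↭ (σ · B ∷ Δ) × Δ ≋ₚ Γ₁
  ≋ₚ-principal Γ≋ r with ≋ₚ-resp-↭ Γ≋ r
  ... | _ ∷ Θ , q , (σ , refl) ∷ p = σ , Θ , q , Pointwise⇒≋ₚ p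

  ≋ₚ-map : (f : Fm Sg → Fm Sg′) → (∀ σ B → σ · f B ≡ f (σ · B)) → Γ′ ≋ₚ Γ → map f Γ′ ≋ₚ map f Γ
  ≋ₚ-map f f-equivariant (Θ , q , p) =
    map f Θ , ↭.map⁺ f q , Pointwise.map⁺ f f (Pointwise.map (λ { (σ , refl) → σ , sym (f-equivariant σ _) }) p)

  ≋ₚ-split : ∀ {Γ₀} n (Δs : Fin n → List (Fm Sg)) → Γ′ ≋ₚ Γ → Γ ↭ (concat (VF.toList Δs) ++ Γ₀) →
             ∃₂ λ (Δs′ : Fin n → List (Fm Sg)) Γ₀′ → Γ′ ↭ (concat (VF.toList Δs′) ++ Γ₀′) ×
               (∀ i → Pointwise _∼ₚ_ (Δs′ i) (Δs i)) × Pointwise _∼ₚ_ Γ₀′ Γ₀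
  ≋ₚ-split n Δs Γ≋ r with ≋ₚ-resp-↭ Γ≋ r
  ... | Θ , q , p with Pointwise-++⁻ (concat (VF.toList Δs)) p
  ... | Θ₁ , Θ₂ , refl , p₁ , p₂ with Pointwise-concat⁻ n Δs p₁
  ... | Δs′ , refl , ps = Δs′ , Θ₂ , q , ps , p₂

  ·-unfold : (σ : Perm) (p : Pred) (s : Sp Sg (predTy p) o) →
             σ · appSp (wk0 (body p)) s ≡ appSp (wk0 (body p)) (permSp σ s)
  ·-unfold σ p s =
    trans (·-appSp σ (wk0 (body p)) s) (cong (λ t → appSp t (permSp σ s)) (·-wk0-fresh σ (body p) (bodyNoNom p)))

  infix 3 _⨾_⊢_ht≤_

  _⨾_⊢_ht≤_ : (Sg : Ctx) → List (Fm Sg) → Fm Sg → Ord → Set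
  Sg ⨾ Γ ⊢ C ht≤ a = Σ (Sg ⨾ Γ ⊢ C) λ Π → ht Π ≤o a

  ⊢-cast : Γ ≡ Γ′ → C ≡ C′ → Sg ⨾ Γ ⊢ C ht≤ a → Sg ⨾ Γ′ ⊢ C′ ht≤ a
  ⊢-cast refl refl Π = Π

  ⊢-castEigen : ∀ {A A′} (e : A ≡ A′) {Γ C} →
                (A ∷ Sg) ⨾ Γ ⊢ C ht≤ a → (A′ ∷ Sg) ⨾ map (castEigen e) Γ ⊢ castEigen e C ht≤ a
  ⊢-castEigen refl {Γ} = ⊢-cast (sym (map-id Γ)) refl

  Permutable : Sg ⨾ Γ ⊢ C → Set
  Permutable {Sg} {Γ} {C} Π = ∀ {Γ′} → Γ′ ≋ₚ Γ → (π : Perm) → Sg ⨾ Γ′ ⊢ π · C ht≤ ht Π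

  permutable-idπ : ∀ {Γ Γ₁ : List (Fm Sg)} (π π′ : Perm) (r : Γ ↭ (B ∷ Γ₁)) (e : π · B ≡ π′ · B′) → Permutable (idπ π π′ r e)
  permutable-idπ {B = B} {B′ = B′} π π′ r e Γ≋ π₀ with ≋ₚ-principal Γ≋ r
  ... | σ , _ , q , _ = idπ (π ∘ₚ invₚ σ) (π′ ∘ₚ invₚ π₀) q permuted-axiom , λ ()
    where
    open ≡-Reasoning
    permuted-axiom : (π ∘ₚ invₚ σ) · σ · B ≡ (π′ ∘ₚ invₚ π₀) · π₀ · B′
    permuted-axiom = begin
      (π ∘ₚ invₚ σ) · σ · B      ≡⟨ ·-cancelʳ π σ B ⟩
      π · B                      ≡⟨ e ⟩
      π′ · B′                    ≡⟨ ·-cancelʳ π′ π₀ B′ ⟨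
      (π′ ∘ₚ invₚ π₀) · π₀ · B′  ∎

  permutable-mc : ∀ {Γc} n (Bs : Fin n → Fm Sg) (Δs : Fin n → List (Fm Sg))
                  {Πs : ∀ i → Sg ⨾ Δs i ⊢ Bs i} {Π : Sg ⨾ VF.toList Bs ++ Γ ⊢ C}
                  (r : Γc ↭ (concat (VF.toList Δs) ++ Γ)) →
                  (∀ i → Permutable (Πs i)) → Permutable Π → Permutable (mc n Bs Δs Πs Π r)
  permutable-mc {Sg = Sg} n Bs Δs {Πs} {Π} r IHs IH Γ≋ π with ≋ₚ-split n Δs Γ≋ r
  ... | Δs′ , Γ₀′ , q , Δs∼ , Γ₀∼ =
    mc n Bs Δs′ (λ i → proj₁ (cut i)) (proj₁ main) q ,
    λ { (inj₁ i) → inj₁ i , proj₂ (cut i) ; (inj₂ _) → inj₂ tt , proj₂ main }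
    where
    cut : ∀ i → Sg ⨾ Δs′ i ⊢ Bs i ht≤ ht (Πs i)
    cut i = ⊢-cast refl (·-identity (Bs i)) (IHs i (Pointwise⇒≋ₚ (Δs∼ i)) idₚ)
    main : Sg ⨾ VF.toList Bs ++ Γ₀′ ⊢ π · _ ht≤ ht Π
    main = IH (Pointwise⇒≋ₚ (Pointwise.++⁺ (Pointwise.refl ∼ₚ-refl) Γ₀∼)) π

  permutable-∀R : ∀ {Γ : List (Fm Sg)} {τ p} {B : Nf Sg (τ ⇒ o)} (cs : List NomC) (L : Lists cs B)
                  {Π : (raise cs τ ∷ Sg) ⨾ map wk Γ ⊢ napp (wk B) (hApp τ cs)} →
                  Permutable Π → Permutable (∀R {p = p} {B = B} cs L Π)
  permutable-∀R {Sg = Sg} {τ = τ} {B = B} cs L {Π} IH {Γ′} Γ≋ π =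
    ∀R (map (π ·ᶜ_) cs) (Lists-· π cs B L) (proj₁ Π′) , λ _ → tt , proj₂ Π′
    where
    e = raise-·ᶜ π cs τ
    Π′ : (raise (map (π ·ᶜ_) cs) τ ∷ Sg) ⨾ map wk Γ′ ⊢ napp (wk (π · B)) (hApp τ (map (π ·ᶜ_) cs)) ht≤ ht Π
    Π′ = ⊢-cast (map-castEigen-wk e Γ′) (·-instantiate τ π B cs)
                (⊢-castEigen e (IH (≋ₚ-map wk ·-wk Γ≋) π))

  permutable-∃L : ∀ {Γ Γ₁ : List (Fm Sg)} {C τ p} {B : Nf Sg (τ ⇒ o)} (cs : List NomC) (L : Lists cs B) (r : Γ ↭ (∃F τ p B ∷ Γ₁))
                  {Π : (raise cs τ ∷ Sg) ⨾ napp (wk B) (hApp τ cs) ∷ map wk Γ₁ ⊢ wk C} →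
                  Permutable Π → Permutable (∃L cs L r Π)
  permutable-∃L {Sg = Sg} {C = C} {τ = τ} {B = B} cs L r {Π} IH Γ≋ π with ≋ₚ-principal Γ≋ r
  ... | σ , Δ , q , Δ≋ = ∃L (map (σ ·ᶜ_) cs) (Lists-· σ cs B L) q (proj₁ Π′) , λ _ → tt , proj₂ Π′
    where
    e = raise-·ᶜ σ cs τ
    Π′ : (raise (map (σ ·ᶜ_) cs) τ ∷ Sg) ⨾ napp (wk (σ · B)) (hApp τ (map (σ ·ᶜ_) cs)) ∷ map wk Δ ⊢ wk (π · C) ht≤ ht Π
    Π′ = ⊢-cast (cong₂ _∷_ (·-instantiate τ σ B cs) (map-castEigen-wk e Δ))
                (trans (cong (castEigen e) (·-wk π C)) (castEigen-wk e (π · C)))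
                (⊢-castEigen e (IH (≋ₚ-∷ (σ , refl) (≋ₚ-map wk ·-wk Δ≋)) π))

  permutable-eqL : ∀ {Γ Γ₁ : List (Fm Sg)} {τ p} {s t : Nf Sg τ} {C}
                   (cs : List NomC) (L : Lists cs (eqF τ p s t)) (r : Γ ↭ (eqF τ p s t ∷ Γ₁))
                   {Πs : ∀ Sg′ (θ : Subst Sg Sg′) → NoNomSub θ → sub (abs cs s) θ ≡ sub (abs cs t) θ →
                         Sg′ ⨾ map (λ B → sub B θ) Γ₁ ⊢ sub C θ} →
                   (∀ Sg′ (θ : Subst Sg Sg′) (fresh : NoNomSub θ) e → Permutable (Πs Sg′ θ fresh e)) → Permutable (eqL {C = C} cs L r Πs)
  permutable-eqL {Sg = Sg} {τ = τ} {p} {s} {t} {C} cs L r {Πs} IHs Γ≋ π with ≋ₚ-principal Γ≋ r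
  ... | σ , Δ , q , Δ≋ =
    eqL (map (σ ·ᶜ_) cs) (Lists-· σ cs (eqF τ p s t) L) q (λ Sg′ θ fresh e → proj₁ (premise Sg′ θ fresh e)) ,
    λ { (Sg′ , θ , fresh , e) → (Sg′ , θ , fresh , solves θ fresh e) , proj₂ (premise Sg′ θ fresh e) }
    where
    solves : ∀ {Sg′} (θ : Subst Sg Sg′) → NoNomSub θ →
             sub (abs (map (σ ·ᶜ_) cs) (σ · s)) θ ≡ sub (abs (map (σ ·ᶜ_) cs) (σ · t)) θ →
             sub (abs cs s) θ ≡ sub (abs cs t) θ
    solves = sub-abs-·⁻ σ cs s t
    premise : ∀ Sg′ (θ : Subst Sg Sg′) (fresh : NoNomSub θ) e →
              Sg′ ⨾ map (λ B → sub B θ) Δ ⊢ sub (π · C) θ ht≤ ht (Πs Sg′ θ fresh (solves θ fresh e))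
    premise Sg′ θ fresh e =
      ⊢-cast refl (·-sub π C θ fresh)
             (IHs Sg′ θ fresh (solves θ fresh e) (≋ₚ-map (λ B → sub B θ) (λ σ′ B → ·-sub σ′ B θ fresh) Δ≋) π)

  permutable-natL : ∀ {Γ Γ₁ : List (Fm Sg)} {I C} (Dn : Nf [] (nt ⇒ o)) (r : Γ ↭ (natF I ∷ Γ₁))
                    {Π₁ : [] ⨾ [] ⊢ napp Dn zF}
                    {Π₂ : (nt ∷ []) ⨾ napp (wk Dn) (ne bnt (var here ∙ ε)) ∷ [] ⊢ napp (wk Dn) (sF (ne bnt (var here ∙ ε)))}
                    {Π₃ : Sg ⨾ napp (wk0 Dn) I ∷ Γ₁ ⊢ C} →
                    Permutable Π₁ → Permutable Π₂ → Permutable Π₃ → Permutable (natL Dn r Π₁ Π₂ Π₃)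
  permutable-natL {I = I} Dn r IH₁ IH₂ IH₃ Γ≋ π with ≋ₚ-principal Γ≋ r
  ... | σ , Δ , q , Δ≋ =
    natL (σ · Dn) q (proj₁ start) (proj₁ step) (proj₁ main) ,
    λ { Fin.zero → Fin.zero , proj₂ start
      ; (Fin.suc Fin.zero) → Fin.suc Fin.zero , proj₂ step
      ; (Fin.suc (Fin.suc Fin.zero)) → Fin.suc (Fin.suc Fin.zero) , proj₂ main }
    where
    x₀ : Nf (nt ∷ []) nt
    x₀ = ne bnt (var here ∙ ε)
    ·-Dn : ∀ {Γ} (ρ : Ren [] Γ) (y : Nf Γ nt) → σ · napp (renNf ρ Dn) y ≡ napp (renNf ρ (σ · Dn)) (σ · y)
    ·-Dn ρ y = trans (·-napp σ (renNf ρ Dn) y) (cong (λ t → napp t (σ · y)) (·-ren σ ρ Dn))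
    start = ⊢-cast refl (·-napp σ Dn zF) (IH₁ (Pointwise⇒≋ₚ []) σ)
    step = ⊢-cast (cong (_∷ []) (·-Dn there x₀)) (·-Dn there (sF x₀))
                  (IH₂ (≋ₚ-∷ (σ , refl) (Pointwise⇒≋ₚ [])) σ)
    main = IH₃ (≋ₚ-∷ (σ , sym (·-Dn _ I)) Δ≋) π

  permutable : (Π : Sg ⨾ Γ ⊢ C) → Permutable Π
  permutable (idπ π π′ r e) = permutable-idπ π π′ r e
  permutable (mc n Bs Δs Πs Π r) = permutable-mc n Bs Δs r (λ i → permutable (Πs i)) (permutable Π)
  permutable (cL r Π) Γ≋ π with ≋ₚ-principal Γ≋ r
  ... | σ , _ , q , Δ≋ with permutable Π (≋ₚ-∷ (σ , refl) (≋ₚ-∷ (σ , refl) Δ≋)) π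
  ... | Π′ , h = cL q Π′ , λ _ → tt , h
  permutable (⊥L r) Γ≋ π with ≋ₚ-principal Γ≋ r
  ... | _ , _ , q , _ = ⊥L q , λ ()
  permutable ⊤R Γ≋ π = ⊤R , λ ()
  permutable (∧L₁ r Π) Γ≋ π with ≋ₚ-principal Γ≋ r
  ... | σ , _ , q , Δ≋ with permutable Π (≋ₚ-∷ (σ , refl) Δ≋) π
  ... | Π′ , h = ∧L₁ q Π′ , λ _ → tt , h
  permutable (∧L₂ r Π) Γ≋ π with ≋ₚ-principal Γ≋ r
  ... | σ , _ , q , Δ≋ with permutable Π (≋ₚ-∷ (σ , refl) Δ≋) π
  ... | Π′ , h = ∧L₂ q Π′ , λ _ → tt , h
  permutable (∧R Π₁ Π₂) Γ≋ π with permutable Π₁ Γ≋ π | permutable Π₂ Γ≋ π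
  ... | Π₁′ , h₁ | Π₂′ , h₂ = ∧R Π₁′ Π₂′ , λ { true → true , h₁ ; false → false , h₂ }
  permutable (∨L r Π₁ Π₂) Γ≋ π with ≋ₚ-principal Γ≋ r
  ... | σ , _ , q , Δ≋ with permutable Π₁ (≋ₚ-∷ (σ , refl) Δ≋) π | permutable Π₂ (≋ₚ-∷ (σ , refl) Δ≋) π
  ... | Π₁′ , h₁ | Π₂′ , h₂ = ∨L q Π₁′ Π₂′ , λ { true → true , h₁ ; false → false , h₂ }
  permutable (∨R₁ Π) Γ≋ π with permutable Π Γ≋ π
  ... | Π′ , h = ∨R₁ Π′ , λ _ → tt , h
  permutable (∨R₂ Π) Γ≋ π with permutable Π Γ≋ π
  ... | Π′ , h = ∨R₂ Π′ , λ _ → tt , h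
  permutable (⊃L r Π₁ Π₂) Γ≋ π with ≋ₚ-principal Γ≋ r
  ... | σ , _ , q , Δ≋ with permutable Π₁ Δ≋ σ | permutable Π₂ (≋ₚ-∷ (σ , refl) Δ≋) π
  ... | Π₁′ , h₁ | Π₂′ , h₂ = ⊃L q Π₁′ Π₂′ , λ { true → true , h₁ ; false → false , h₂ }
  permutable (⊃R Π) Γ≋ π with permutable Π (≋ₚ-∷ (π , refl) Γ≋) π
  ... | Π′ , h = ⊃R Π′ , λ _ → tt , h
  permutable (∀L {B = B} t r Π) Γ≋ π with ≋ₚ-principal Γ≋ r
  ... | σ , _ , q , Δ≋ with permutable Π (≋ₚ-∷ (σ , sym (·-napp σ B t)) Δ≋) π
  ... | Π′ , h = ∀L (σ · t) q Π′ , λ _ → tt , h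
  permutable (∀R cs L Π) = permutable-∀R cs L (permutable Π)
  permutable (∃L cs L r Π) = permutable-∃L cs L r (permutable Π)
  permutable (∃R {B = B} t Π) Γ≋ π with ⊢-cast refl (·-napp π B t) (permutable Π Γ≋ π)
  ... | Π′ , h = ∃R (π · t) Π′ , λ _ → tt , h
  permutable (∇L {k = k} {B = B} a a∉B r Π) Γ≋ π with ≋ₚ-principal Γ≋ r
  ... | σ , _ , q , Δ≋ with permutable Π (≋ₚ-∷ (σ , sym (·-napp σ B (nmNf (k , a)))) Δ≋) π
  ... | Π′ , h = ∇L (Perm.fun σ k a) (∉supp-· σ B a∉B) q Π′ , λ _ → tt , h
  permutable (∇R {k = k} {B = B} a a∉B Π) Γ≋ π with ⊢-cast refl (·-napp π B (nmNf (k , a))) (permutable Π Γ≋ π)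
  ... | Π′ , h = ∇R (Perm.fun π k a) (∉supp-· π B a∉B) Π′ , λ _ → tt , h
  permutable eqR Γ≋ π = eqR , λ ()
  permutable (eqL cs L r Πs) = permutable-eqL cs L r (λ Sg′ θ fresh e → permutable (Πs Sg′ θ fresh e))
  permutable (defL p s r Π) Γ≋ π with ≋ₚ-principal Γ≋ r
  ... | σ , _ , q , Δ≋ with permutable Π (≋ₚ-∷ (σ , sym (·-unfold σ p s)) Δ≋) π
  ... | Π′ , h = defL p (permSp σ s) q Π′ , λ _ → tt , h
  permutable (defR p s Π) Γ≋ π with ⊢-cast refl (·-unfold π p s) (permutable Π Γ≋ π)
  ... | Π′ , h = defR p (permSp π s) Π′ , λ _ → tt , h
  permutable natRz Γ≋ π = natRz , λ ()
  permutable (natRs Π) Γ≋ π with permutable Π Γ≋ π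
  ... | Π′ , h = natRs Π′ , λ _ → tt , h
  permutable (natL Dn r Π₁ Π₂ Π₃) = permutable-natL Dn r (permutable Π₁) (permutable Π₂) (permutable Π₃)

lemma6 : (S : Sig) (D : Terms.Defn S) → Logic.PermutationLemma S D
lemma6 S D Bs B₀ π₀ πs Π = permutable Π (Pointwise⇒≋ₚ (tabulate⁺ (λ i → πs i , refl))) π₀
  where open Equivariance S D
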